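{- Let $K = \mathbb{Q}(\sqrt{ -5})$. Then the graph $\Gamma(K^2)$ is triangle-free (it contains no three pairwise adjacent vertices), but its chromatic number $\chi(K^2)$ is exactly $3$.
   Context: For a nonzero commutative ring $E$ and an integer $d \geq 1$, $\Gamma(E^d)$ denotes the graph whose vertices are the $d$-tuples in $E^d$, with an edge between $(x_1,\ldots,x_d)$ and $(x'_1,\ldots,x'_d)$ whenever $(x'_1-x_1)^2+\cdots+(x'_d-x_d)^2 = 1$. $\chi(E^d)$ denotes its chromatic number (possibly $+\infty$). The axiom of choice is assumed. -}

module Defs where

open import Data.Nat using (ℕ; _<_)
open import Data.Integer using (+_)
open import Data.Rational as ℚ using (ℚ; 0ℚ; 1ℚ)
open import Data.Fin using (Fin)
open import Data.Product using (Σ; _×_)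
open import Relation.Binary.PropositionalEquality using (_≡_; _≢_)
open import Relation.Nullary using (¬_)
open import Data.Empty using (⊥)

-- K = ℚ(√-5), elements a + b√-5 represented as pairs (a , b) of rationals.
-- Since ℚ is normalised, propositional equality on K is field equality.
record K : Set where
  constructor _+_√-5
  field
    re : ℚ
    im : ℚ

five : ℚ
five = + 5 ℚ./ 1

infixl 6 _+K_ _-K_
infixl 7 _*K_

_+K_ : K → K → K
(a + b √-5) +K (c + d √-5) = (a ℚ.+ c) + (b ℚ.+ d) √-5

_-K_ : K → K → K
(a + b √-5) -K (c + d √-5) = (a ℚ.- c) + (b ℚ.- d) √-5

_*K_ : K → K → K
(a + b √-5) *K (c + d √-5) = (a ℚ.* c ℚ.- five ℚ.* (b ℚ.* d)) + (a ℚ.* d ℚ.+ b ℚ.* c) √-5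

0K : K
0K = 0ℚ + 0ℚ √-5

1K : K
1K = 1ℚ + 0ℚ √-5

K² : Set
K² = K × K

open Data.Product using (_,_)

Adj : K² → K² → Set
Adj (x , y) (x' , y') =
  (x' -K x) *K (x' -K x) +K (y' -K y) *K (y' -K y) ≡ 1K

ProperColouring : {V : Set} → (V → V → Set) → (n : ℕ) → (V → Fin n) → Set
ProperColouring E n c = ∀ u v → E u v → c u ≢ c v

Colourable : {V : Set} → (V → V → Set) → ℕ → Set
Colourable E n = Σ (_ → Fin n) (ProperColouring E n)

ChromaticNumber : {V : Set} → (V → V → Set) → ℕ → Set
ChromaticNumber E n = Colourable E n × (∀ m → m < n → ¬ Colourable E m)

TriangleFree : {V : Set} → (V → V → Set) → Set
TriangleFree E = ∀ u v w → E u v → E v w → E u w → ⊥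

module Submission where

-- Triangle-freeness: for a triangle with unit sides, Heron's formula gives
-- (2 det)² = 4·1·1 − (1 + 1 − 1)² = 3, but 3 is not a square in ℚ(√-5): after
-- clearing denominators, a² − 5b² = 3n² with ab = 0 is impossible by a 3-adic
-- descent (b = 0) or by sign (a = 0).
--
-- Three colours: two adjacent points differ by (a + b√-5, c + d√-5) with
-- (a + b√-5)² + (c + d√-5)² = 1.  Modulo 3 we have √-5 ≡ ±1, and a descent on the
-- power of 3 in a common denominator shows that a + b + c + d is a 3-adic unit.
-- Adding a 3-adic unit changes the 3-adic units digit, so colouring a point by the
-- units digit of the sum of its four rational coordinates is proper.  Two colours
-- do not suffice because Γ(K²) contains a 5-cycle.

open import Defs
open import Data.Product using (_×_; Σ; _,_; proj₁; proj₂)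
open import Level using (0ℓ)
open import Data.Sum using (inj₁; inj₂)
open import Relation.Nullary using (¬_; yes; no)
open import Relation.Nullary.Decidable using (from-yes; _→-dec_; _×-dec_; ¬?)
open import Relation.Binary.PropositionalEquality
open import Data.Nat as ℕ using (ℕ; zero; suc)
import Data.Nat.Properties as ℕP
import Data.Nat.DivMod as ℕD
open import Data.Nat.Induction using (<-rec)
open import Data.Fin using (Fin; toℕ)
open import Data.Fin.Properties using (all?; _≟_)
open import Data.Integer as ℤ using (ℤ; +_; -[1+_]; _⊖_; _/ℕ_)
import Data.Integer.Properties as ℤP
import Data.Integer.DivMod as ℤD
open import Data.Integer.Solver renaming (module +-*-Solver to ℤ-Solver)
open import Data.Rational as ℚ using (ℚ; ↥_; ↧_; toℚᵘ)
import Data.Rational.Properties as ℚP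
open import Data.Rational.Solver renaming (module +-*-Solver to ℚ-Solver)
open import Data.Rational.Unnormalised as ℚᵘ using (mkℚᵘ; *≡*)
import Data.Rational.Unnormalised.Properties as ℚᵘP
open import Data.Vec using (Vec; []; _∷_)
open import Data.Vec.Relation.Unary.All as All using (All; []; _∷_)
open import Algebra.Bundles.Raw using (RawRing)

-- The field F₃ and reduction modulo 3

F₃ : Set
F₃ = Fin 3

pattern 𝟎 = Fin.zero
pattern 𝟏 = Fin.suc Fin.zero
pattern 𝟐 = Fin.suc (Fin.suc Fin.zero)

infixl 6 _+₃_ _-₃_
infixl 7 _*₃_

_+₃_ : F₃ → F₃ → F₃
𝟎 +₃ y = y
𝟏 +₃ 𝟎 = 𝟏
𝟏 +₃ 𝟏 = 𝟐
𝟏 +₃ 𝟐 = 𝟎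
𝟐 +₃ 𝟎 = 𝟐
𝟐 +₃ 𝟏 = 𝟎
𝟐 +₃ 𝟐 = 𝟏

neg₃ : F₃ → F₃
neg₃ 𝟎 = 𝟎
neg₃ 𝟏 = 𝟐
neg₃ 𝟐 = 𝟏

_-₃_ : F₃ → F₃ → F₃
x -₃ y = x +₃ neg₃ y

_*₃_ : F₃ → F₃ → F₃
𝟎 *₃ y = 𝟎
𝟏 *₃ y = y
𝟐 *₃ y = neg₃ y

F₃-rawRing : RawRing 0ℓ 0ℓ
F₃-rawRing = record
  { Carrier = F₃ ; _≈_ = _≡_ ; _+_ = _+₃_ ; _*_ = _*₃_ ; -_ = neg₃ ; 0# = 𝟎 ; 1# = 𝟏 }

+₃-identityʳ : ∀ x → x +₃ 𝟎 ≡ x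
+₃-identityʳ = from-yes (all? λ x → x +₃ 𝟎 ≟ x)

*₃-zeroʳ : ∀ x → x *₃ 𝟎 ≡ 𝟎
*₃-zeroʳ = from-yes (all? λ x → x *₃ 𝟎 ≟ 𝟎)

*₃-unit : ∀ x y → x ≢ 𝟎 → y ≢ 𝟎 → x *₃ y ≢ 𝟎
*₃-unit = from-yes (all? λ x → all? λ y → ¬? (x ≟ 𝟎) →-dec (¬? (y ≟ 𝟎) →-dec ¬? (x *₃ y ≟ 𝟎)))

mod₃ℕ : ℕ → F₃
mod₃ℕ zero    = 𝟎
mod₃ℕ (suc n) = mod₃ℕ n +₃ 𝟏

mod₃ : ℤ → F₃
mod₃ (+ n)     = mod₃ℕ n
mod₃ -[1+ n ] = neg₃ (mod₃ℕ (suc n))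

mod₃ℕ-+ : ∀ m n → mod₃ℕ (m ℕ.+ n) ≡ mod₃ℕ m +₃ mod₃ℕ n
mod₃ℕ-+ zero    n = refl
mod₃ℕ-+ (suc m) n = trans (cong (_+₃ 𝟏) (mod₃ℕ-+ m n)) (+₃-suc (mod₃ℕ m) (mod₃ℕ n))
  where
  +₃-suc : ∀ x y → x +₃ y +₃ 𝟏 ≡ x +₃ 𝟏 +₃ y
  +₃-suc = from-yes (all? λ x → all? λ y → x +₃ y +₃ 𝟏 ≟ x +₃ 𝟏 +₃ y)

mod₃ℕ-* : ∀ m n → mod₃ℕ (m ℕ.* n) ≡ mod₃ℕ m *₃ mod₃ℕ n
mod₃ℕ-* zero    n = refl
mod₃ℕ-* (suc m) n = trans (mod₃ℕ-+ n (m ℕ.* n))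
  (trans (cong (mod₃ℕ n +₃_) (mod₃ℕ-* m n)) (*₃-suc (mod₃ℕ m) (mod₃ℕ n)))
  where
  *₃-suc : ∀ x y → y +₃ x *₃ y ≡ (x +₃ 𝟏) *₃ y
  *₃-suc = from-yes (all? λ x → all? λ y → y +₃ x *₃ y ≟ (x +₃ 𝟏) *₃ y)

mod₃-neg : ∀ x → mod₃ (ℤ.- x) ≡ neg₃ (mod₃ x)
mod₃-neg (+ zero)  = refl
mod₃-neg (+ suc n) = refl
mod₃-neg -[1+ n ]  = sym (neg₃-involutive (mod₃ℕ (suc n)))
  where
  neg₃-involutive : ∀ x → neg₃ (neg₃ x) ≡ x
  neg₃-involutive = from-yes (all? λ x → neg₃ (neg₃ x) ≟ x)

mod₃-⊖ : ∀ m n → mod₃ (m ⊖ n) ≡ mod₃ℕ m -₃ mod₃ℕ n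
mod₃-⊖ m       zero    = trans (cong mod₃ (ℤP.⊖-≥ {m} {0} ℕ.z≤n)) (sym (-₃-identityʳ (mod₃ℕ m)))
  where
  -₃-identityʳ : ∀ x → x -₃ 𝟎 ≡ x
  -₃-identityʳ = from-yes (all? λ x → x -₃ 𝟎 ≟ x)
mod₃-⊖ zero    (suc n) = cong mod₃ (ℤP.⊖-< {0} {suc n} (ℕ.s≤s ℕ.z≤n))
mod₃-⊖ (suc m) (suc n) = trans (cong mod₃ (ℤP.[1+m]⊖[1+n]≡m⊖n m n))
  (trans (mod₃-⊖ m n) (-₃-suc (mod₃ℕ m) (mod₃ℕ n)))
  where
  -₃-suc : ∀ x y → x -₃ y ≡ (x +₃ 𝟏) -₃ (y +₃ 𝟏)
  -₃-suc = from-yes (all? λ x → all? λ y → x -₃ y ≟ (x +₃ 𝟏) -₃ (y +₃ 𝟏))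

mod₃-+ : ∀ x y → mod₃ (x ℤ.+ y) ≡ mod₃ x +₃ mod₃ y
mod₃-+ (+ m)     (+ n)     = mod₃ℕ-+ m n
mod₃-+ (+ m)     -[1+ n ] = mod₃-⊖ m (suc n)
mod₃-+ -[1+ m ] (+ n)     = trans (mod₃-⊖ n (suc m)) (+₃-comm (mod₃ℕ n) _)
  where
  +₃-comm : ∀ x y → x +₃ y ≡ y +₃ x
  +₃-comm = from-yes (all? λ x → all? λ y → x +₃ y ≟ y +₃ x)
mod₃-+ -[1+ m ] -[1+ n ] = trans
  (cong neg₃ (trans (cong (λ k → mod₃ℕ (suc k)) (sym (ℕP.+-suc m n))) (mod₃ℕ-+ (suc m) (suc n))))
  (neg₃-distrib-+₃ (mod₃ℕ (suc m)) (mod₃ℕ (suc n)))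
  where
  neg₃-distrib-+₃ : ∀ x y → neg₃ (x +₃ y) ≡ neg₃ x +₃ neg₃ y
  neg₃-distrib-+₃ = from-yes (all? λ x → all? λ y → neg₃ (x +₃ y) ≟ neg₃ x +₃ neg₃ y)

mod₃-*⁺ : ∀ m y → mod₃ (+ m ℤ.* y) ≡ mod₃ℕ m *₃ mod₃ y
mod₃-*⁺ m (+ n)     = trans (cong mod₃ (sym (ℤP.pos-* m n))) (mod₃ℕ-* m n)
mod₃-*⁺ m -[1+ n ] = begin
  mod₃ (+ m ℤ.* ℤ.- + suc n)       ≡⟨ cong mod₃ (sym (ℤP.neg-distribʳ-* (+ m) (+ suc n))) ⟩
  mod₃ (ℤ.- (+ m ℤ.* + suc n))     ≡⟨ mod₃-neg (+ m ℤ.* + suc n) ⟩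
  neg₃ (mod₃ (+ m ℤ.* + suc n))    ≡⟨ cong neg₃ (mod₃-*⁺ m (+ suc n)) ⟩
  neg₃ (mod₃ℕ m *₃ mod₃ℕ (suc n))  ≡⟨ neg₃-distribʳ-*₃ (mod₃ℕ m) (mod₃ℕ (suc n)) ⟩
  mod₃ℕ m *₃ neg₃ (mod₃ℕ (suc n))  ∎
  where
  open ≡-Reasoning
  neg₃-distribʳ-*₃ : ∀ x y → neg₃ (x *₃ y) ≡ x *₃ neg₃ y
  neg₃-distribʳ-*₃ = from-yes (all? λ x → all? λ y → neg₃ (x *₃ y) ≟ x *₃ neg₃ y)

mod₃-* : ∀ x y → mod₃ (x ℤ.* y) ≡ mod₃ x *₃ mod₃ y
mod₃-* (+ m)     y = mod₃-*⁺ m y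
mod₃-* -[1+ m ] y = begin
  mod₃ (ℤ.- + suc m ℤ.* y)         ≡⟨ cong mod₃ (sym (ℤP.neg-distribˡ-* (+ suc m) y)) ⟩
  mod₃ (ℤ.- (+ suc m ℤ.* y))       ≡⟨ mod₃-neg (+ suc m ℤ.* y) ⟩
  neg₃ (mod₃ (+ suc m ℤ.* y))      ≡⟨ cong neg₃ (mod₃-*⁺ (suc m) y) ⟩
  neg₃ (mod₃ℕ (suc m) *₃ mod₃ y)   ≡⟨ neg₃-distribˡ-*₃ (mod₃ℕ (suc m)) (mod₃ y) ⟩
  neg₃ (mod₃ℕ (suc m)) *₃ mod₃ y   ∎
  where
  open ≡-Reasoning
  neg₃-distribˡ-*₃ : ∀ x y → neg₃ (x *₃ y) ≡ neg₃ x *₃ y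
  neg₃-distribˡ-*₃ = from-yes (all? λ x → all? λ y → neg₃ (x *₃ y) ≟ neg₃ x *₃ y)

mod₃-- : ∀ x y → mod₃ (x ℤ.- y) ≡ mod₃ x -₃ mod₃ y
mod₃-- x y = trans (mod₃-+ x (ℤ.- y)) (cong (mod₃ x +₃_) (mod₃-neg y))

mod₃-*3 : ∀ x → mod₃ (x ℤ.* + 3) ≡ 𝟎
mod₃-*3 x = trans (mod₃-* x (+ 3)) (*₃-zeroʳ (mod₃ x))

_/3 : ℤ → ℤ
x /3 = x /ℕ 3

mod₃≡𝟎⇒x≡[x/3]*3 : ∀ x → mod₃ x ≡ 𝟎 → x ≡ x /3 ℤ.* + 3
mod₃≡𝟎⇒x≡[x/3]*3 x x≡0 = by-remainder (x ℤ.%ℕ 3) (ℤD.n%ℕd<d x 3) (ℤD.a≡a%ℕn+[a/ℕn]*n x 3)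
  where
  residue : ∀ r → x ≡ + r ℤ.+ x /3 ℤ.* + 3 → mod₃ x ≡ mod₃ℕ r
  residue r eq = trans (cong mod₃ eq) (trans (mod₃-+ (+ r) (x /3 ℤ.* + 3))
    (trans (cong (mod₃ℕ r +₃_) (mod₃-*3 (x /3))) (+₃-identityʳ (mod₃ℕ r))))
  by-remainder : ∀ r → r ℕ.< 3 → x ≡ + r ℤ.+ x /3 ℤ.* + 3 → x ≡ x /3 ℤ.* + 3
  by-remainder 0 _ eq = trans eq (ℤP.+-identityˡ _)
  by-remainder 1 _ eq with () ← trans (sym (residue 1 eq)) x≡0
  by-remainder 2 _ eq with () ← trans (sym (residue 2 eq)) x≡0
  by-remainder (suc (suc (suc _))) (ℕ.s≤s (ℕ.s≤s (ℕ.s≤s ()))) _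

divisible₃ : ∀ x → mod₃ x ≡ 𝟎 → Σ ℤ λ y → x ≡ y ℤ.* + 3
divisible₃ x 3∣x = x /3 , mod₃≡𝟎⇒x≡[x/3]*3 x 3∣x

/3-exact : ∀ {x} y → x ≡ y ℤ.* + 3 → x /3 ≡ y
/3-exact {x} y x≡3y = ℤP.*-cancelʳ-≡ (x /3) y (+ 3)
  (trans (sym (mod₃≡𝟎⇒x≡[x/3]*3 x (trans (cong mod₃ x≡3y) (mod₃-*3 y)))) x≡3y)

3^_ : ℕ → ℤ
3^ k = (+ 3) ℤ.^ k

lift₃ : F₃ → ℤ
lift₃ j = + toℕ j

-- digit p m k is the k-th 3-adic digit of p / m (for 3 ∤ m).  The 0-th digit is
-- p m⁻¹ = p m in F₃, as m² = 1; subtracting it and dividing by 3 leaves peel p m / m.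

digit₀ : ℤ → ℤ → F₃
digit₀ p m = mod₃ p *₃ mod₃ m

peel : ℤ → ℤ → ℤ
peel p m = (p ℤ.- lift₃ (digit₀ p m) ℤ.* m) /3

digit : ℤ → ℤ → ℕ → F₃
digit p m zero    = digit₀ p m
digit p m (suc k) = digit (peel p m) m k

peel-exact : ∀ p m → mod₃ m ≢ 𝟎 → p ℤ.- lift₃ (digit₀ p m) ℤ.* m ≡ peel p m ℤ.* + 3
peel-exact p m m≢0 = mod₃≡𝟎⇒x≡[x/3]*3 _ (begin
  mod₃ (p ℤ.- lift₃ d ℤ.* m)          ≡⟨ mod₃-- p (lift₃ d ℤ.* m) ⟩
  mod₃ p -₃ mod₃ (lift₃ d ℤ.* m)      ≡⟨ cong (mod₃ p -₃_) (mod₃-* (lift₃ d) m) ⟩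
  mod₃ p -₃ mod₃ (lift₃ d) *₃ mod₃ m  ≡⟨ cong (λ j → mod₃ p -₃ j *₃ mod₃ m) (mod₃-lift₃ d) ⟩
  mod₃ p -₃ d *₃ mod₃ m               ≡⟨ unit-inverse (mod₃ p) (mod₃ m) m≢0 ⟩
  𝟎                                   ∎)
  where
  open ≡-Reasoning
  d = digit₀ p m
  mod₃-lift₃ : ∀ j → mod₃ (lift₃ j) ≡ j
  mod₃-lift₃ = from-yes (all? λ j → mod₃ (lift₃ j) ≟ j)
  unit-inverse : ∀ x y → y ≢ 𝟎 → x -₃ x *₃ y *₃ y ≡ 𝟎
  unit-inverse = from-yes (all? λ x → all? λ y → ¬? (y ≟ 𝟎) →-dec (x -₃ x *₃ y *₃ y ≟ 𝟎))

digit₀-*ʳ : ∀ p m t → mod₃ t ≢ 𝟎 → digit₀ (p ℤ.* t) (m ℤ.* t) ≡ digit₀ p m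
digit₀-*ʳ p m t t≢0 = trans (cong₂ _*₃_ (mod₃-* p t) (mod₃-* m t)) (cancel (mod₃ p) (mod₃ m) (mod₃ t) t≢0)
  where
  cancel : ∀ x y t → t ≢ 𝟎 → x *₃ t *₃ (y *₃ t) ≡ x *₃ y
  cancel = from-yes (all? λ x → all? λ y → all? λ t → ¬? (t ≟ 𝟎) →-dec (x *₃ t *₃ (y *₃ t) ≟ x *₃ y))

digit₀-*-swap : ∀ u v m → mod₃ m ≢ 𝟎 → digit₀ (u ℤ.* m) (m ℤ.* v) ≡ digit₀ u v
digit₀-*-swap u v m m≢0 = trans (cong₂ _*₃_ (mod₃-* u m) (mod₃-* m v)) (cancel (mod₃ u) (mod₃ v) (mod₃ m) m≢0)
  where
  cancel : ∀ x y t → t ≢ 𝟎 → x *₃ t *₃ (t *₃ y) ≡ x *₃ y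
  cancel = from-yes (all? λ x → all? λ y → all? λ t → ¬? (t ≟ 𝟎) →-dec (x *₃ t *₃ (t *₃ y) ≟ x *₃ y))

digit-*ʳ : ∀ k p m t → mod₃ m ≢ 𝟎 → mod₃ t ≢ 𝟎 → digit (p ℤ.* t) (m ℤ.* t) k ≡ digit p m k
digit-*ʳ zero    p m t m≢0 t≢0 = digit₀-*ʳ p m t t≢0
digit-*ʳ (suc k) p m t m≢0 t≢0 =
  trans (cong (λ z → digit z (m ℤ.* t) k) peel-*ʳ) (digit-*ʳ k (peel p m) m t m≢0 t≢0)
  where
  open ≡-Reasoning
  open ℤ-Solver
  e = lift₃ (digit₀ p m)
  peel-*ʳ : peel (p ℤ.* t) (m ℤ.* t) ≡ peel p m ℤ.* t
  peel-*ʳ = /3-exact (peel p m ℤ.* t) (begin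
    p ℤ.* t ℤ.- lift₃ (digit₀ (p ℤ.* t) (m ℤ.* t)) ℤ.* (m ℤ.* t)
      ≡⟨ cong (λ j → p ℤ.* t ℤ.- lift₃ j ℤ.* (m ℤ.* t)) (digit₀-*ʳ p m t t≢0) ⟩
    p ℤ.* t ℤ.- e ℤ.* (m ℤ.* t)
      ≡⟨ solve 4 (λ p t e m → p :* t :- e :* (m :* t) := (p :- e :* m) :* t) refl p t e m ⟩
    (p ℤ.- e ℤ.* m) ℤ.* t
      ≡⟨ cong (ℤ._* t) (peel-exact p m m≢0) ⟩
    peel p m ℤ.* + 3 ℤ.* t
      ≡⟨ solve 2 (λ q t → q :* con (+ 3) :* t := q :* t :* con (+ 3)) refl (peel p m) t ⟩
    peel p m ℤ.* t ℤ.* + 3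
      ∎)

digit-3* : ∀ k p m → digit (+ 3 ℤ.* p) m (suc k) ≡ digit p m k
digit-3* k p m = cong (λ z → digit z m k) (/3-exact p (begin
  + 3 ℤ.* p ℤ.- lift₃ (digit₀ (+ 3 ℤ.* p) m) ℤ.* m
    ≡⟨ cong (λ j → + 3 ℤ.* p ℤ.- lift₃ (j *₃ mod₃ m) ℤ.* m) (mod₃-* (+ 3) p) ⟩
  + 3 ℤ.* p ℤ.- + 0 ℤ.* m
    ≡⟨ solve 2 (λ p m → con (+ 3) :* p :- con (+ 0) :* m := p :* con (+ 3)) refl p m ⟩
  p ℤ.* + 3
    ∎))
  where open ≡-Reasoning; open ℤ-Solver

digit-3^* : ∀ j k p m → digit (3^ j ℤ.* p) m (j ℕ.+ k) ≡ digit p m k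
digit-3^* zero    k p m = cong (λ z → digit z m k) (ℤP.*-identityˡ p)
digit-3^* (suc j) k p m = begin
  digit (3^ suc j ℤ.* p) m (suc j ℕ.+ k)        ≡⟨ cong (λ z → digit z m (suc j ℕ.+ k)) (ℤP.*-assoc (+ 3) (3^ j) p) ⟩
  digit (+ 3 ℤ.* (3^ j ℤ.* p)) m (suc j ℕ.+ k)  ≡⟨ digit-3* (j ℕ.+ k) (3^ j ℤ.* p) m ⟩
  digit (3^ j ℤ.* p) m (j ℕ.+ k)                ≡⟨ digit-3^* j k p m ⟩
  digit p m k                                   ∎
  where open ≡-Reasoning

digit-+ : ∀ k p w m → mod₃ m ≢ 𝟎 → digit (p ℤ.+ 3^ k ℤ.* w) m k ≡ digit p m k +₃ digit₀ w m
digit-+ zero p w m _ = begin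
  mod₃ (p ℤ.+ + 1 ℤ.* w) *₃ mod₃ m      ≡⟨ cong (λ z → mod₃ (p ℤ.+ z) *₃ mod₃ m) (ℤP.*-identityˡ w) ⟩
  mod₃ (p ℤ.+ w) *₃ mod₃ m              ≡⟨ cong (_*₃ mod₃ m) (mod₃-+ p w) ⟩
  (mod₃ p +₃ mod₃ w) *₃ mod₃ m          ≡⟨ *₃-distribʳ-+₃ (mod₃ m) (mod₃ p) (mod₃ w) ⟩
  mod₃ p *₃ mod₃ m +₃ mod₃ w *₃ mod₃ m  ∎
  where
  open ≡-Reasoning
  *₃-distribʳ-+₃ : ∀ z x y → (x +₃ y) *₃ z ≡ x *₃ z +₃ y *₃ z
  *₃-distribʳ-+₃ = from-yes (all? λ z → all? λ x → all? λ y → (x +₃ y) *₃ z ≟ x *₃ z +₃ y *₃ z)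
digit-+ (suc k) p w m m≢0 = trans (cong (λ z → digit z m k) peel-+) (digit-+ k (peel p m) w m m≢0)
  where
  open ≡-Reasoning
  open ℤ-Solver
  P = 3^ k
  q = p ℤ.+ + 3 ℤ.* P ℤ.* w
  e = lift₃ (digit₀ p m)
  same-residue : mod₃ q ≡ mod₃ p
  same-residue = begin
    mod₃ q                            ≡⟨ mod₃-+ p (+ 3 ℤ.* P ℤ.* w) ⟩
    mod₃ p +₃ mod₃ (+ 3 ℤ.* P ℤ.* w)  ≡⟨ cong (mod₃ p +₃_) (trans (mod₃-* (+ 3 ℤ.* P) w) (cong (_*₃ mod₃ w) (mod₃-* (+ 3) P))) ⟩
    mod₃ p +₃ 𝟎                       ≡⟨ +₃-identityʳ (mod₃ p) ⟩
    mod₃ p                            ∎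
  peel-+ : peel q m ≡ peel p m ℤ.+ P ℤ.* w
  peel-+ = /3-exact (peel p m ℤ.+ P ℤ.* w) (begin
    q ℤ.- lift₃ (digit₀ q m) ℤ.* m          ≡⟨ cong (λ j → q ℤ.- lift₃ (j *₃ mod₃ m) ℤ.* m) same-residue ⟩
    q ℤ.- e ℤ.* m                           ≡⟨ solve 5 (λ p P w e m → p :+ con (+ 3) :* P :* w :- e :* m
                                                                    := (p :- e :* m) :+ P :* w :* con (+ 3)) refl p P w e m ⟩
    (p ℤ.- e ℤ.* m) ℤ.+ P ℤ.* w ℤ.* + 3     ≡⟨ cong (ℤ._+ P ℤ.* w ℤ.* + 3) (peel-exact p m m≢0) ⟩
    peel p m ℤ.* + 3 ℤ.+ P ℤ.* w ℤ.* + 3    ≡⟨ ℤP.*-distribʳ-+ (+ 3) (peel p m) (P ℤ.* w) ⟨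
    (peel p m ℤ.+ P ℤ.* w) ℤ.* + 3          ∎)

digit-cong : ∀ p₁ m₁ k₁ p₂ m₂ k₂ → mod₃ m₁ ≢ 𝟎 → mod₃ m₂ ≢ 𝟎 →
             p₁ ℤ.* (3^ k₂ ℤ.* m₂) ≡ p₂ ℤ.* (3^ k₁ ℤ.* m₁) → digit p₁ m₁ k₁ ≡ digit p₂ m₂ k₂
digit-cong p₁ m₁ k₁ p₂ m₂ k₂ m₁≢0 m₂≢0 eq = begin
  digit p₁ m₁ k₁                                          ≡⟨ digit-*ʳ k₁ p₁ m₁ m₂ m₁≢0 m₂≢0 ⟨
  digit (p₁ ℤ.* m₂) (m₁ ℤ.* m₂) k₁                        ≡⟨ digit-3^* k₂ k₁ (p₁ ℤ.* m₂) (m₁ ℤ.* m₂) ⟨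
  digit (3^ k₂ ℤ.* (p₁ ℤ.* m₂)) (m₁ ℤ.* m₂) (k₂ ℕ.+ k₁)  ≡⟨ cong₂ (λ z n → digit z (m₁ ℤ.* m₂) n) cross (ℕP.+-comm k₂ k₁) ⟩
  digit (3^ k₁ ℤ.* (p₂ ℤ.* m₁)) (m₁ ℤ.* m₂) (k₁ ℕ.+ k₂)  ≡⟨ cong (λ m → digit (3^ k₁ ℤ.* (p₂ ℤ.* m₁)) m (k₁ ℕ.+ k₂)) (ℤP.*-comm m₁ m₂) ⟩
  digit (3^ k₁ ℤ.* (p₂ ℤ.* m₁)) (m₂ ℤ.* m₁) (k₁ ℕ.+ k₂)  ≡⟨ digit-3^* k₁ k₂ (p₂ ℤ.* m₁) (m₂ ℤ.* m₁) ⟩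
  digit (p₂ ℤ.* m₁) (m₂ ℤ.* m₁) k₂                        ≡⟨ digit-*ʳ k₂ p₂ m₂ m₁ m₂≢0 m₁≢0 ⟩
  digit p₂ m₂ k₂                                          ∎
  where
  open ≡-Reasoning
  open ℤ-Solver
  cross : 3^ k₂ ℤ.* (p₁ ℤ.* m₂) ≡ 3^ k₁ ℤ.* (p₂ ℤ.* m₁)
  cross = begin
    3^ k₂ ℤ.* (p₁ ℤ.* m₂)  ≡⟨ solve 3 (λ P p m → P :* (p :* m) := p :* (P :* m)) refl (3^ k₂) p₁ m₂ ⟩
    p₁ ℤ.* (3^ k₂ ℤ.* m₂)  ≡⟨ eq ⟩
    p₂ ℤ.* (3^ k₁ ℤ.* m₁)  ≡⟨ solve 3 (λ P p m → p :* (P :* m) := P :* (p :* m)) refl (3^ k₁) p₂ m₁ ⟩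
    3^ k₁ ℤ.* (p₂ ℤ.* m₁)  ∎

Factorisation₃ : ℤ → Set
Factorisation₃ n = Σ ℕ λ k → Σ ℤ λ m → n ≡ 3^ k ℤ.* m × mod₃ m ≢ 𝟎

factorisation₃-*3 : ∀ {x} → Factorisation₃ x → Factorisation₃ (x ℤ.* + 3)
factorisation₃-*3 (k , m , x≡3^km , 3∤m) = suc k , m ,
  trans (cong (ℤ._* + 3) x≡3^km) (solve 2 (λ P m → P :* m :* con (+ 3) := con (+ 3) :* P :* m) refl (3^ k) m) ,
  3∤m
  where open ℤ-Solver

factorise₃ : ∀ n → Factorisation₃ (+ suc n)
factorise₃ = <-rec (λ n → Factorisation₃ (+ suc n)) split
  where
  split : ∀ n → (∀ {n′} → n′ ℕ.< n → Factorisation₃ (+ suc n′)) → Factorisation₃ (+ suc n)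
  split n rec with mod₃ℕ (suc n) ≟ 𝟎
  ... | no 3∤n  = 0 , + suc n , sym (ℤP.*-identityˡ (+ suc n)) , 3∤n
  ... | yes 3∣n with suc n ℕD./ 3
                   | ℤP.+-injective (trans (mod₃≡𝟎⇒x≡[x/3]*3 (+ suc n) 3∣n) (sym (ℤP.pos-* (suc n ℕD./ 3) 3)))
  ...   | suc q | n≡q*3 = subst Factorisation₃ (sym (trans (cong +_ n≡q*3) (ℤP.pos-* (suc q) 3)))
                                 (factorisation₃-*3 (rec q<n))
    where
    q<n : q ℕ.< n
    q<n = subst (q ℕ.<_) (sym (ℕP.suc-injective n≡q*3)) (ℕ.s≤s (ℕP.m≤n⇒m≤1+n (ℕP.m≤m*n q 3)))

opaque
  ι : ℤ → ℚ
  ι z = z ℚ./ 1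

opaque
  unfolding ι

  toℚᵘ-ι : ∀ z → toℚᵘ (ι z) ℚᵘ.≃ mkℚᵘ z 0
  toℚᵘ-ι z = ℚP.toℚᵘ-fromℚᵘ (mkℚᵘ z 0)

  ι-0 : ι (+ 0) ≡ ℚ.0ℚ
  ι-0 = refl

  ι-3 : ι (+ 3) ≡ + 3 ℚ./ 1
  ι-3 = refl

  ι-5 : ι (+ 5) ≡ five
  ι-5 = refl

ι-+ : ∀ x y → ι (x ℤ.+ y) ≡ ι x ℚ.+ ι y
ι-+ x y = ℚP.toℚᵘ-injective (begin
  toℚᵘ (ι (x ℤ.+ y))          ≈⟨ toℚᵘ-ι (x ℤ.+ y) ⟩
  mkℚᵘ (x ℤ.+ y) 0            ≈⟨ *≡* (solve 2 (λ x y → (x :+ y) :* con (+ 1) := (x :* con (+ 1) :+ y :* con (+ 1)) :* con (+ 1)) refl x y) ⟩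
  mkℚᵘ x 0 ℚᵘ.+ mkℚᵘ y 0      ≈⟨ ℚᵘP.+-cong (toℚᵘ-ι x) (toℚᵘ-ι y) ⟨
  toℚᵘ (ι x) ℚᵘ.+ toℚᵘ (ι y)  ≈⟨ ℚP.toℚᵘ-homo-+ (ι x) (ι y) ⟨
  toℚᵘ (ι x ℚ.+ ι y)          ∎)
  where open ℚᵘP.≃-Reasoning; open ℤ-Solver

ι-* : ∀ x y → ι (x ℤ.* y) ≡ ι x ℚ.* ι y
ι-* x y = ℚP.toℚᵘ-injective (begin
  toℚᵘ (ι (x ℤ.* y))          ≈⟨ toℚᵘ-ι (x ℤ.* y) ⟩
  mkℚᵘ x 0 ℚᵘ.* mkℚᵘ y 0      ≈⟨ ℚᵘP.*-cong (toℚᵘ-ι x) (toℚᵘ-ι y) ⟨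
  toℚᵘ (ι x) ℚᵘ.* toℚᵘ (ι y)  ≈⟨ ℚP.toℚᵘ-homo-* (ι x) (ι y) ⟨
  toℚᵘ (ι x ℚ.* ι y)          ∎)
  where open ℚᵘP.≃-Reasoning

ι-neg : ∀ x → ι (ℤ.- x) ≡ ℚ.- ι x
ι-neg x = ℚP.toℚᵘ-injective (begin
  toℚᵘ (ι (ℤ.- x))  ≈⟨ toℚᵘ-ι (ℤ.- x) ⟩
  ℚᵘ.- mkℚᵘ x 0     ≈⟨ ℚᵘP.-‿cong (toℚᵘ-ι x) ⟨
  ℚᵘ.- toℚᵘ (ι x)   ≈⟨ ℚP.toℚᵘ-homo‿- (ι x) ⟨
  toℚᵘ (ℚ.- ι x)    ∎)
  where open ℚᵘP.≃-Reasoning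

ι-injective : ∀ {x y} → ι x ≡ ι y → x ≡ y
ι-injective {x} {y} ιx≡ιy
  with *≡* eq ← ℚᵘP.≃-trans (ℚᵘP.≃-sym (toℚᵘ-ι x)) (ℚᵘP.≃-trans (ℚP.toℚᵘ-cong ιx≡ιy) (toℚᵘ-ι y)) =
  trans (sym (ℤP.*-identityʳ x)) (trans eq (ℤP.*-identityʳ y))

ι-*-cancelʳ : ∀ {x y} c → c ≢ + 0 → x ℚ.* ι c ≡ y ℚ.* ι c → x ≡ y
ι-*-cancelʳ {x} {y} c c≢0 xc≡yc = ℚP.toℚᵘ-injective (begin
  toℚᵘ x                         ≈⟨ ℚᵘP.*-identityʳ (toℚᵘ x) ⟨
  toℚᵘ x ℚᵘ.* ℚᵘ.1ℚᵘ             ≈⟨ ℚᵘP.*-congˡ {toℚᵘ x} (ℚᵘP.*-inverseʳ C) ⟨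
  toℚᵘ x ℚᵘ.* (C ℚᵘ.* ℚᵘ.1/ C)   ≈⟨ ℚᵘP.*-assoc (toℚᵘ x) C (ℚᵘ.1/ C) ⟨
  toℚᵘ x ℚᵘ.* C ℚᵘ.* ℚᵘ.1/ C     ≈⟨ ℚᵘP.*-congʳ (toℚᵘ-*ι x) ⟩
  toℚᵘ (x ℚ.* ι c) ℚᵘ.* ℚᵘ.1/ C  ≡⟨ cong (λ z → toℚᵘ z ℚᵘ.* ℚᵘ.1/ C) xc≡yc ⟩
  toℚᵘ (y ℚ.* ι c) ℚᵘ.* ℚᵘ.1/ C  ≈⟨ ℚᵘP.*-congʳ (toℚᵘ-*ι y) ⟨
  toℚᵘ y ℚᵘ.* C ℚᵘ.* ℚᵘ.1/ C     ≈⟨ ℚᵘP.*-assoc (toℚᵘ y) C (ℚᵘ.1/ C) ⟩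
  toℚᵘ y ℚᵘ.* (C ℚᵘ.* ℚᵘ.1/ C)   ≈⟨ ℚᵘP.*-congˡ {toℚᵘ y} (ℚᵘP.*-inverseʳ C) ⟩
  toℚᵘ y ℚᵘ.* ℚᵘ.1ℚᵘ             ≈⟨ ℚᵘP.*-identityʳ (toℚᵘ y) ⟩
  toℚᵘ y                         ∎)
  where
  open ℚᵘP.≃-Reasoning
  C = mkℚᵘ c 0
  instance
    c-nonZero : ℤ.NonZero c
    c-nonZero = ℤ.≢-nonZero c≢0
  toℚᵘ-*ι : ∀ z → toℚᵘ z ℚᵘ.* C ℚᵘ.≃ toℚᵘ (z ℚ.* ι c)
  toℚᵘ-*ι z = ℚᵘP.≃-trans (ℚᵘP.*-congˡ {toℚᵘ z} (ℚᵘP.≃-sym (toℚᵘ-ι c))) (ℚᵘP.≃-sym (ℚP.toℚᵘ-homo-* z (ι c)))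

p*↧p≡↥p : ∀ a → a ℚ.* ι (↧ a) ≡ ι (↥ a)
p*↧p≡↥p a@(ℚ.mkℚ p d _) = ℚP.toℚᵘ-injective (begin
  toℚᵘ (a ℚ.* ι (↧ a))            ≈⟨ ℚP.toℚᵘ-homo-* a (ι (↧ a)) ⟩
  toℚᵘ a ℚᵘ.* toℚᵘ (ι (↧ a))      ≈⟨ ℚᵘP.*-congˡ {toℚᵘ a} (toℚᵘ-ι (↧ a)) ⟩
  mkℚᵘ (p ℤ.* + suc d) (d ℕ.* 1)  ≈⟨ *≡* (trans (ℤP.*-identityʳ (p ℤ.* + suc d)) (cong (λ e → p ℤ.* + suc e) (sym (ℕP.*-identityʳ d)))) ⟩
  mkℚᵘ p 0                        ≈⟨ toℚᵘ-ι p ⟨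
  toℚᵘ (ι p)                      ∎)
  where open ℚᵘP.≃-Reasoning

ι-cross : ∀ x {d p d′ p′} → x ℚ.* ι d ≡ ι p → x ℚ.* ι d′ ≡ ι p′ → p ℤ.* d′ ≡ p′ ℤ.* d
ι-cross x {d} {p} {d′} {p′} xd≡p xd′≡p′ = ι-injective (begin
  ι (p ℤ.* d′)        ≡⟨ ι-* p d′ ⟩
  ι p ℚ.* ι d′        ≡⟨ cong (ℚ._* ι d′) xd≡p ⟨
  x ℚ.* ι d ℚ.* ι d′  ≡⟨ solve 3 (λ x a b → x :* a :* b := x :* b :* a) refl x (ι d) (ι d′) ⟩
  x ℚ.* ι d′ ℚ.* ι d  ≡⟨ cong (ℚ._* ι d) xd′≡p′ ⟩
  ι p′ ℚ.* ι d        ≡⟨ ι-* p′ d ⟨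
  ι (p′ ℤ.* d)        ∎)
  where open ≡-Reasoning; open ℚ-Solver

-- The 3-adic units digit of a rational number

unitsDigit : ℚ → F₃
unitsDigit q = let k , m , _ = factorise₃ (ℚ.denominator-1 q) in digit (↥ q) m k

unitsDigit-rep : ∀ q p k m → q ℚ.* ι (3^ k ℤ.* m) ≡ ι p → mod₃ m ≢ 𝟎 → unitsDigit q ≡ digit p m k
unitsDigit-rep q p k m rep 3∤m with k′ , m′ , ↧q≡3^km , 3∤m′ ← factorise₃ (ℚ.denominator-1 q) =
  digit-cong (↥ q) m′ k′ p m k 3∤m′ 3∤m (ι-cross q (subst (λ n → q ℚ.* ι n ≡ ι (↥ q)) ↧q≡3^km (p*↧p≡↥p q)) rep)

unitsDigit-+ : ∀ q s U M → s ℚ.* ι M ≡ ι U → mod₃ M ≢ 𝟎 → unitsDigit (q ℚ.+ s) ≡ unitsDigit q +₃ digit₀ U M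
unitsDigit-+ q s U M sM≡U 3∤M with k , m , ↧q≡3^km , 3∤m ← factorise₃ (ℚ.denominator-1 q) = begin
  unitsDigit (q ℚ.+ s)                                           ≡⟨ unitsDigit-rep (q ℚ.+ s) p′ k (m ℤ.* M) rep 3∤mM ⟩
  digit p′ (m ℤ.* M) k                                           ≡⟨ digit-+ k (↥ q ℤ.* M) (U ℤ.* m) (m ℤ.* M) 3∤mM ⟩
  digit (↥ q ℤ.* M) (m ℤ.* M) k +₃ digit₀ (U ℤ.* m) (m ℤ.* M)    ≡⟨ cong₂ _+₃_ (digit-*ʳ k (↥ q) m M 3∤m 3∤M) (digit₀-*-swap U M m 3∤m) ⟩
  digit (↥ q) m k +₃ digit₀ U M                                  ∎
  where
  open ≡-Reasoning
  p′ = ↥ q ℤ.* M ℤ.+ 3^ k ℤ.* (U ℤ.* m)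
  3∤mM : mod₃ (m ℤ.* M) ≢ 𝟎
  3∤mM 3∣mM = *₃-unit (mod₃ m) (mod₃ M) 3∤m 3∤M (trans (sym (mod₃-* m M)) 3∣mM)
  q-rep : q ℚ.* (ι (3^ k) ℚ.* ι m) ≡ ι (↥ q)
  q-rep = subst (λ n → q ℚ.* n ≡ ι (↥ q)) (trans (cong ι ↧q≡3^km) (ι-* (3^ k) m)) (p*↧p≡↥p q)
  rep : (q ℚ.+ s) ℚ.* ι (3^ k ℤ.* (m ℤ.* M)) ≡ ι p′
  rep = begin
    (q ℚ.+ s) ℚ.* ι (3^ k ℤ.* (m ℤ.* M))
      ≡⟨ cong ((q ℚ.+ s) ℚ.*_) (trans (ι-* (3^ k) (m ℤ.* M)) (cong (ι (3^ k) ℚ.*_) (ι-* m M))) ⟩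
    (q ℚ.+ s) ℚ.* (ι (3^ k) ℚ.* (ι m ℚ.* ι M))
      ≡⟨ solve 5 (λ q s P m M → (q :+ s) :* (P :* (m :* M)) := q :* (P :* m) :* M :+ P :* (s :* M :* m))
               refl q s (ι (3^ k)) (ι m) (ι M) ⟩
    q ℚ.* (ι (3^ k) ℚ.* ι m) ℚ.* ι M ℚ.+ ι (3^ k) ℚ.* (s ℚ.* ι M ℚ.* ι m)
      ≡⟨ cong₂ (λ a b → a ℚ.* ι M ℚ.+ ι (3^ k) ℚ.* (b ℚ.* ι m)) q-rep sM≡U ⟩
    ι (↥ q) ℚ.* ι M ℚ.+ ι (3^ k) ℚ.* (ι U ℚ.* ι m)
      ≡⟨ cong₂ ℚ._+_ (ι-* (↥ q) M) (trans (ι-* (3^ k) (U ℤ.* m)) (cong (ι (3^ k) ℚ.*_) (ι-* U m))) ⟨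
    ι (↥ q ℤ.* M) ℚ.+ ι (3^ k ℤ.* (U ℤ.* m))
      ≡⟨ ι-+ (↥ q ℤ.* M) (3^ k ℤ.* (U ℤ.* m)) ⟨
    ι p′
      ∎
    where open ℚ-Solver

-- (a + b√-f)² = re² f a b + im² a b √-f
module Square (R : RawRing 0ℓ 0ℓ) where
  open RawRing R

  re² : Carrier → Carrier → Carrier → Carrier
  re² f a b = a * a + - (f * (b * b))

  im² : Carrier → Carrier → Carrier
  im² a b = a * b + b * a

  Qre : Carrier → Carrier → Carrier → Carrier → Carrier → Carrier
  Qre f a b c d = re² f a b + re² f c d

  Qim : Carrier → Carrier → Carrier → Carrier → Carrier
  Qim a b c d = im² a b + im² c d

module ℤ√ = Square ℤ.+-*-rawRing
module ℚ√ = Square ℚ.+-*-rawRing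
module F₃√ = Square F₃-rawRing

module SquareHomomorphism (R S : RawRing 0ℓ 0ℓ) (φ : RawRing.Carrier R → RawRing.Carrier S)
  (+-homo : ∀ x y → φ (RawRing._+_ R x y) ≡ RawRing._+_ S (φ x) (φ y))
  (*-homo : ∀ x y → φ (RawRing._*_ R x y) ≡ RawRing._*_ S (φ x) (φ y))
  (-‿homo : ∀ x → φ (RawRing.-_ R x) ≡ RawRing.-_ S (φ x))
  where
  private
    module R = Square R
    module S = Square S
    open RawRing S using (_+_; _*_; -_)

  re²-homo : ∀ f a b → φ (R.re² f a b) ≡ S.re² (φ f) (φ a) (φ b)
  re²-homo f a b = trans (+-homo _ _) (cong₂ _+_ (*-homo a a)
    (trans (-‿homo _) (cong -_ (trans (*-homo f _) (cong (φ f *_) (*-homo b b))))))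

  im²-homo : ∀ a b → φ (R.im² a b) ≡ S.im² (φ a) (φ b)
  im²-homo a b = trans (+-homo _ _) (cong₂ _+_ (*-homo a b) (*-homo b a))

  Qre-homo : ∀ f a b c d → φ (R.Qre f a b c d) ≡ S.Qre (φ f) (φ a) (φ b) (φ c) (φ d)
  Qre-homo f a b c d = trans (+-homo _ _) (cong₂ _+_ (re²-homo f a b) (re²-homo f c d))

  Qim-homo : ∀ a b c d → φ (R.Qim a b c d) ≡ S.Qim (φ a) (φ b) (φ c) (φ d)
  Qim-homo a b c d = trans (+-homo _ _) (cong₂ _+_ (im²-homo a b) (im²-homo c d))

open SquareHomomorphism ℤ.+-*-rawRing F₃-rawRing mod₃ mod₃-+ mod₃-* mod₃-neg
  using () renaming (Qre-homo to mod₃-Qre; Qim-homo to mod₃-Qim)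
open SquareHomomorphism ℤ.+-*-rawRing ℚ.+-*-rawRing ι ι-+ ι-* ι-neg
  using () renaming (re²-homo to ι-re²; im²-homo to ι-im²)

*ι-scaleʳ : ∀ a {n A} r → a ℚ.* ι n ≡ ι A → a ℚ.* ι (n ℤ.* r) ≡ ι (A ℤ.* r)
*ι-scaleʳ a {n} {A} r an≡A = begin
  a ℚ.* ι (n ℤ.* r)    ≡⟨ cong (a ℚ.*_) (ι-* n r) ⟩
  a ℚ.* (ι n ℚ.* ι r)  ≡⟨ ℚP.*-assoc a (ι n) (ι r) ⟨
  a ℚ.* ι n ℚ.* ι r    ≡⟨ cong (ℚ._* ι r) an≡A ⟩
  ι A ℚ.* ι r          ≡⟨ ι-* A r ⟨
  ι (A ℤ.* r)          ∎
  where open ≡-Reasoning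

common-denominator : ∀ {k} (v : Vec ℚ k) → Σ ℕ λ n → All (λ a → Σ ℤ λ A → a ℚ.* ι (+ suc n) ≡ ι A) v
common-denominator []                      = 0 , []
common-denominator (a@(ℚ.mkℚ p d _) ∷ v) with n , v-cleared ← common-denominator v =
  n ℕ.+ d ℕ.* suc n ,
  (p ℤ.* + suc n , *ι-scaleʳ a (+ suc n) (p*↧p≡↥p a)) ∷
  All.map (λ {b} (B , bn≡B) → B ℤ.* + suc d ,
            subst (λ z → b ℚ.* ι z ≡ ι (B ℤ.* + suc d)) (ℤP.*-comm (+ suc n) (+ suc d)) (*ι-scaleʳ b (+ suc d) bn≡B))
          v-cleared

ι-re²-cleared : ∀ f a b n {A B} → a ℚ.* ι n ≡ ι A → b ℚ.* ι n ≡ ι B →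
                ι (ℤ√.re² f A B) ≡ ℚ√.re² (ι f) a b ℚ.* (ι n ℚ.* ι n)
ι-re²-cleared f a b n an≡A bn≡B = trans (ι-re² f _ _)
  (trans (cong₂ (ℚ√.re² (ι f)) (sym an≡A) (sym bn≡B)) (re²-scaled (ι f) a b (ι n)))
  where
  open ℚ-Solver
  re²-scaled : ∀ f a b n → ℚ√.re² f (a ℚ.* n) (b ℚ.* n) ≡ ℚ√.re² f a b ℚ.* (n ℚ.* n)
  re²-scaled = solve 4 (λ f a b n → (a :* n) :* (a :* n) :- f :* ((b :* n) :* (b :* n))
                                     := (a :* a :- f :* (b :* b)) :* (n :* n)) refl

ι-im²-cleared : ∀ a b n {A B} → a ℚ.* ι n ≡ ι A → b ℚ.* ι n ≡ ι B →
                ι (ℤ√.im² A B) ≡ ℚ√.im² a b ℚ.* (ι n ℚ.* ι n)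
ι-im²-cleared a b n an≡A bn≡B = trans (ι-im² _ _)
  (trans (cong₂ ℚ√.im² (sym an≡A) (sym bn≡B)) (im²-scaled a b (ι n)))
  where
  open ℚ-Solver
  im²-scaled : ∀ a b n → ℚ√.im² (a ℚ.* n) (b ℚ.* n) ≡ ℚ√.im² a b ℚ.* (n ℚ.* n)
  im²-scaled = solve 3 (λ a b n → (a :* n) :* (b :* n) :+ (b :* n) :* (a :* n)
                                   := (a :* b :+ b :* a) :* (n :* n)) refl

ι-Qre-cleared : ∀ f a b c d n {A B C D} → a ℚ.* ι n ≡ ι A → b ℚ.* ι n ≡ ι B → c ℚ.* ι n ≡ ι C → d ℚ.* ι n ≡ ι D →
                ι (ℤ√.Qre f A B C D) ≡ ℚ√.Qre (ι f) a b c d ℚ.* (ι n ℚ.* ι n)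
ι-Qre-cleared f a b c d n aA bB cC dD = trans (ι-+ _ _)
  (trans (cong₂ ℚ._+_ (ι-re²-cleared f a b n aA bB) (ι-re²-cleared f c d n cC dD))
         (sym (ℚP.*-distribʳ-+ (ι n ℚ.* ι n) (ℚ√.re² (ι f) a b) (ℚ√.re² (ι f) c d))))

ι-Qim-cleared : ∀ a b c d n {A B C D} → a ℚ.* ι n ≡ ι A → b ℚ.* ι n ≡ ι B → c ℚ.* ι n ≡ ι C → d ℚ.* ι n ≡ ι D →
                ι (ℤ√.Qim A B C D) ≡ ℚ√.Qim a b c d ℚ.* (ι n ℚ.* ι n)
ι-Qim-cleared a b c d n aA bB cC dD = trans (ι-+ _ _)
  (trans (cong₂ ℚ._+_ (ι-im²-cleared a b n aA bB) (ι-im²-cleared c d n cC dD))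
         (sym (ℚP.*-distribʳ-+ (ι n ℚ.* ι n) (ℚ√.im² a b) (ℚ√.im² c d))))

ι-sum-cleared : ∀ a b c d n {A B C D} → a ℚ.* ι n ≡ ι A → b ℚ.* ι n ≡ ι B → c ℚ.* ι n ≡ ι C → d ℚ.* ι n ≡ ι D →
                (a ℚ.+ b ℚ.+ c ℚ.+ d) ℚ.* ι n ≡ ι (A ℤ.+ B ℤ.+ C ℤ.+ D)
ι-sum-cleared a b c d n {A} {B} {C} {D} aA bB cC dD = begin
  (a ℚ.+ b ℚ.+ c ℚ.+ d) ℚ.* ι n
    ≡⟨ solve 5 (λ a b c d n → (a :+ b :+ c :+ d) :* n := a :* n :+ b :* n :+ c :* n :+ d :* n) refl a b c d (ι n) ⟩
  a ℚ.* ι n ℚ.+ b ℚ.* ι n ℚ.+ c ℚ.* ι n ℚ.+ d ℚ.* ι n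
    ≡⟨ cong₂ ℚ._+_ (cong₂ ℚ._+_ (cong₂ ℚ._+_ aA bB) cC) dD ⟩
  ι A ℚ.+ ι B ℚ.+ ι C ℚ.+ ι D
    ≡⟨ trans (ι-+ (A ℤ.+ B ℤ.+ C) D) (cong (ℚ._+ ι D) (trans (ι-+ (A ℤ.+ B) C) (cong (ℚ._+ ι C) (ι-+ A B)))) ⟨
  ι (A ℤ.+ B ℤ.+ C ℤ.+ D)
    ∎
  where open ≡-Reasoning; open ℚ-Solver

ι-rep-cancel : ∀ s c m U → c ≢ + 0 → s ℚ.* ι (c ℤ.* m) ≡ ι (c ℤ.* U) → s ℚ.* ι m ≡ ι U
ι-rep-cancel s c m U c≢0 eq = ι-*-cancelʳ c c≢0 (begin
  s ℚ.* ι m ℚ.* ι c    ≡⟨ ℚP.*-assoc s (ι m) (ι c) ⟩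
  s ℚ.* (ι m ℚ.* ι c)  ≡⟨ cong (s ℚ.*_) (trans (cong ι (ℤP.*-comm c m)) (ι-* m c)) ⟨
  s ℚ.* ι (c ℤ.* m)    ≡⟨ eq ⟩
  ι (c ℤ.* U)          ≡⟨ trans (cong ι (ℤP.*-comm c U)) (ι-* U c) ⟩
  ι U ℚ.* ι c          ∎)
  where open ≡-Reasoning

-- Descent modulo 3

-- Modulo 3, √-5 ↦ ±1 turns Qre ± Qim into (a ± b)² + (c ± d)², and a sum of two
-- squares in F₃ vanishes only if both do, since −1 is not a square.

isotropic₃ : ∀ a b c d → F₃√.Qre 𝟐 a b c d ≡ 𝟎 → F₃√.Qim a b c d ≡ 𝟎 → a ≡ 𝟎 × b ≡ 𝟎 × c ≡ 𝟎 × d ≡ 𝟎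
isotropic₃ = from-yes (all? λ a → all? λ b → all? λ c → all? λ d →
  (F₃√.Qre 𝟐 a b c d ≟ 𝟎) →-dec ((F₃√.Qim a b c d ≟ 𝟎) →-dec
  ((a ≟ 𝟎) ×-dec (b ≟ 𝟎) ×-dec (c ≟ 𝟎) ×-dec (d ≟ 𝟎))))

unit-vector-sum₃ : ∀ a b c d → F₃√.Qre 𝟐 a b c d ≡ 𝟏 → F₃√.Qim a b c d ≡ 𝟎 → a +₃ b +₃ c +₃ d ≢ 𝟎
unit-vector-sum₃ = from-yes (all? λ a → all? λ b → all? λ c → all? λ d →
  (F₃√.Qre 𝟐 a b c d ≟ 𝟏) →-dec ((F₃√.Qim a b c d ≟ 𝟎) →-dec ¬? (a +₃ b +₃ c +₃ d ≟ 𝟎)))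

mod₃-sum : ∀ A B C D → mod₃ (A ℤ.+ B ℤ.+ C ℤ.+ D) ≡ mod₃ A +₃ mod₃ B +₃ mod₃ C +₃ mod₃ D
mod₃-sum A B C D = trans (mod₃-+ (A ℤ.+ B ℤ.+ C) D)
  (cong (_+₃ mod₃ D) (trans (mod₃-+ (A ℤ.+ B) C) (cong (_+₃ mod₃ C) (mod₃-+ A B))))

mod₃-3^suc* : ∀ k m → mod₃ (3^ suc k ℤ.* m) ≡ 𝟎
mod₃-3^suc* k m = trans (mod₃-* (3^ suc k) m) (cong (_*₃ mod₃ m) (mod₃-* (+ 3) (3^ k)))

Qre-*3 : ∀ f a b c d → ℤ√.Qre f (a ℤ.* + 3) (b ℤ.* + 3) (c ℤ.* + 3) (d ℤ.* + 3) ≡ ℤ√.Qre f a b c d ℤ.* + 9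
Qre-*3 = solve 5 (λ f a b c d →
  (a :* con (+ 3)) :* (a :* con (+ 3)) :- f :* ((b :* con (+ 3)) :* (b :* con (+ 3)))
  :+ ((c :* con (+ 3)) :* (c :* con (+ 3)) :- f :* ((d :* con (+ 3)) :* (d :* con (+ 3))))
  := (a :* a :- f :* (b :* b) :+ (c :* c :- f :* (d :* d))) :* con (+ 9)) refl
  where open ℤ-Solver

Qim-*3 : ∀ a b c d → ℤ√.Qim (a ℤ.* + 3) (b ℤ.* + 3) (c ℤ.* + 3) (d ℤ.* + 3) ≡ ℤ√.Qim a b c d ℤ.* + 9
Qim-*3 = solve 4 (λ a b c d →
  (a :* con (+ 3)) :* (b :* con (+ 3)) :+ (b :* con (+ 3)) :* (a :* con (+ 3))
  :+ ((c :* con (+ 3)) :* (d :* con (+ 3)) :+ (d :* con (+ 3)) :* (c :* con (+ 3)))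
  := (a :* b :+ b :* a :+ (c :* d :+ d :* c)) :* con (+ 9)) refl
  where open ℤ-Solver

descent : ∀ k A B C D m → mod₃ m ≢ 𝟎 →
          ℤ√.Qre (+ 5) A B C D ≡ 3^ k ℤ.* m ℤ.* (3^ k ℤ.* m) → ℤ√.Qim A B C D ≡ + 0 →
          Σ ℤ λ U → mod₃ U ≢ 𝟎 × A ℤ.+ B ℤ.+ C ℤ.+ D ≡ 3^ k ℤ.* U
descent zero A B C D m 3∤m Qre≡m² Qim≡0 = A ℤ.+ B ℤ.+ C ℤ.+ D , 3∤sum , sym (ℤP.*-identityˡ _)
  where
  unit-square : ∀ x → x ≢ 𝟎 → x *₃ x ≡ 𝟏
  unit-square = from-yes (all? λ x → ¬? (x ≟ 𝟎) →-dec (x *₃ x ≟ 𝟏))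
  Qre≡1 : F₃√.Qre 𝟐 (mod₃ A) (mod₃ B) (mod₃ C) (mod₃ D) ≡ 𝟏
  Qre≡1 = trans (sym (mod₃-Qre (+ 5) A B C D)) (trans (cong mod₃ Qre≡m²)
    (trans (mod₃-* (+ 1 ℤ.* m) (+ 1 ℤ.* m)) (trans (cong₂ _*₃_ (mod₃-* (+ 1) m) (mod₃-* (+ 1) m))
      (unit-square (mod₃ m) 3∤m))))
  3∤sum : mod₃ (A ℤ.+ B ℤ.+ C ℤ.+ D) ≢ 𝟎
  3∤sum 3∣sum = unit-vector-sum₃ (mod₃ A) (mod₃ B) (mod₃ C) (mod₃ D) Qre≡1
    (trans (sym (mod₃-Qim A B C D)) (cong mod₃ Qim≡0)) (trans (sym (mod₃-sum A B C D)) 3∣sum)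
descent (suc k) A B C D m 3∤m Qre≡ Qim≡0
  with isotropic₃ (mod₃ A) (mod₃ B) (mod₃ C) (mod₃ D)
         (trans (sym (mod₃-Qre (+ 5) A B C D)) (trans (cong mod₃ Qre≡)
           (trans (mod₃-* (3^ suc k ℤ.* m) (3^ suc k ℤ.* m)) (cong₂ _*₃_ (mod₃-3^suc* k m) (mod₃-3^suc* k m)))))
         (trans (sym (mod₃-Qim A B C D)) (cong mod₃ Qim≡0))
... | 3∣A , 3∣B , 3∣C , 3∣D
  with A′ , refl ← divisible₃ A 3∣A | B′ , refl ← divisible₃ B 3∣B
     | C′ , refl ← divisible₃ C 3∣C | D′ , refl ← divisible₃ D 3∣D =
  let U , 3∤U , sum′≡3^kU = descent k A′ B′ C′ D′ m 3∤m Qre′ Qim′ in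
  U , 3∤U , trans (solve 4 (λ a b c d → a :* con (+ 3) :+ b :* con (+ 3) :+ c :* con (+ 3) :+ d :* con (+ 3)
                                       := con (+ 3) :* (a :+ b :+ c :+ d)) refl A′ B′ C′ D′)
                  (trans (cong (+ 3 ℤ.*_) sum′≡3^kU) (sym (ℤP.*-assoc (+ 3) (3^ k) U)))
  where
  open ℤ-Solver
  Qre′ : ℤ√.Qre (+ 5) A′ B′ C′ D′ ≡ 3^ k ℤ.* m ℤ.* (3^ k ℤ.* m)
  Qre′ = ℤP.*-cancelʳ-≡ _ _ (+ 9) (trans (sym (Qre-*3 (+ 5) A′ B′ C′ D′)) (trans Qre≡
    (solve 2 (λ P m → con (+ 3) :* P :* m :* (con (+ 3) :* P :* m) := P :* m :* (P :* m) :* con (+ 9)) refl (3^ k) m)))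
  Qim′ : ℤ√.Qim A′ B′ C′ D′ ≡ + 0
  Qim′ = ℤP.*-cancelʳ-≡ _ _ (+ 9) (trans (sym (Qim-*3 A′ B′ C′ D′)) Qim≡0)

3^≢0 : ∀ k → 3^ k ≢ + 0
3^≢0 k 3^k≡0 with () ← ℤP.i^n≡0⇒i≡0 (+ 3) k 3^k≡0

IsUnit₃ : ℚ → Set
IsUnit₃ s = Σ ℤ λ U → Σ ℤ λ M → s ℚ.* ι M ≡ ι U × mod₃ U ≢ 𝟎 × mod₃ M ≢ 𝟎

unit-vector-sum-isUnit₃ : ∀ a b c d → ℚ√.Qre five a b c d ≡ ℚ.1ℚ → ℚ√.Qim a b c d ≡ ℚ.0ℚ →
                          IsUnit₃ (a ℚ.+ b ℚ.+ c ℚ.+ d)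
unit-vector-sum-isUnit₃ a b c d Qre≡1 Qim≡0
  with n , (A , aA) ∷ (B , bB) ∷ (C , cC) ∷ (D , dD) ∷ [] ← common-denominator (a ∷ b ∷ c ∷ d ∷ [])
  with k , m , N≡3^km , 3∤m ← factorise₃ n =
  let U , 3∤U , sum≡3^kU = descent k A B C D m 3∤m (subst (λ z → ℤ√.Qre (+ 5) A B C D ≡ z ℤ.* z) N≡3^km Qre-cleared) Qim-cleared in
  U , m , ι-rep-cancel (a ℚ.+ b ℚ.+ c ℚ.+ d) (3^ k) m U (3^≢0 k)
            (subst (λ z → (a ℚ.+ b ℚ.+ c ℚ.+ d) ℚ.* ι z ≡ ι (3^ k ℤ.* U)) N≡3^km
                   (trans (ι-sum-cleared a b c d N aA bB cC dD) (cong ι sum≡3^kU))) ,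
  3∤U , 3∤m
  where
  open ≡-Reasoning
  N = + suc n
  Qre-cleared : ℤ√.Qre (+ 5) A B C D ≡ N ℤ.* N
  Qre-cleared = ι-injective (begin
    ι (ℤ√.Qre (+ 5) A B C D)                    ≡⟨ ι-Qre-cleared (+ 5) a b c d N aA bB cC dD ⟩
    ℚ√.Qre (ι (+ 5)) a b c d ℚ.* (ι N ℚ.* ι N)  ≡⟨ cong (λ f → ℚ√.Qre f a b c d ℚ.* (ι N ℚ.* ι N)) ι-5 ⟩
    ℚ√.Qre five a b c d ℚ.* (ι N ℚ.* ι N)       ≡⟨ cong (ℚ._* (ι N ℚ.* ι N)) Qre≡1 ⟩
    ℚ.1ℚ ℚ.* (ι N ℚ.* ι N)                      ≡⟨ ℚP.*-identityˡ (ι N ℚ.* ι N) ⟩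
    ι N ℚ.* ι N                                 ≡⟨ ι-* N N ⟨
    ι (N ℤ.* N)                                 ∎)
  Qim-cleared : ℤ√.Qim A B C D ≡ + 0
  Qim-cleared = ι-injective (begin
    ι (ℤ√.Qim A B C D)                          ≡⟨ ι-Qim-cleared a b c d N aA bB cC dD ⟩
    ℚ√.Qim a b c d ℚ.* (ι N ℚ.* ι N)            ≡⟨ cong (ℚ._* (ι N ℚ.* ι N)) Qim≡0 ⟩
    ℚ.0ℚ ℚ.* (ι N ℚ.* ι N)                      ≡⟨ ℚP.*-zeroˡ (ι N ℚ.* ι N) ⟩
    ℚ.0ℚ                                        ≡⟨ ι-0 ⟨
    ι (+ 0)                                     ∎)

-- A proper 3-colouring

coordinateSum : K² → ℚ
coordinateSum (x , y) = K.re x ℚ.+ K.im x ℚ.+ K.re y ℚ.+ K.im y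

colour : K² → F₃
colour v = unitsDigit (coordinateSum v)

adjacent-isUnit₃ : ∀ u v → Adj u v → IsUnit₃ (coordinateSum v ℚ.- coordinateSum u)
adjacent-isUnit₃ (x , y) (x′ , y′) adj =
  subst IsUnit₃ (solve 8 (λ a b c d a′ b′ c′ d′ → (a′ :- a) :+ (b′ :- b) :+ (c′ :- c) :+ (d′ :- d)
                                                  := a′ :+ b′ :+ c′ :+ d′ :- (a :+ b :+ c :+ d))
                   refl (K.re x) (K.im x) (K.re y) (K.im y) (K.re x′) (K.im x′) (K.re y′) (K.im y′))
    (unit-vector-sum-isUnit₃ (K.re x′ ℚ.- K.re x) (K.im x′ ℚ.- K.im x) (K.re y′ ℚ.- K.re y) (K.im y′ ℚ.- K.im y)
                             (cong K.re adj) (cong K.im adj))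
  where open ℚ-Solver

colour-proper : ProperColouring Adj 3 colour
colour-proper u v adj same =
  let U , M , sM≡U , 3∤U , 3∤M = adjacent-isUnit₃ u v adj in
  shift-moves (colour u) (digit₀ U M) (*₃-unit (mod₃ U) (mod₃ M) 3∤U 3∤M) (begin
    colour u                            ≡⟨ same ⟩
    colour v                            ≡⟨ cong unitsDigit (solve 2 (λ p q → p := q :+ (p :- q)) refl (coordinateSum v) (coordinateSum u)) ⟩
    unitsDigit (coordinateSum u ℚ.+ s)  ≡⟨ unitsDigit-+ (coordinateSum u) s U M sM≡U 3∤M ⟩
    colour u +₃ digit₀ U M              ∎)
  where
  open ≡-Reasoning
  open ℚ-Solver
  s = coordinateSum v ℚ.- coordinateSum u
  shift-moves : ∀ x δ → δ ≢ 𝟎 → x ≢ x +₃ δ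
  shift-moves = from-yes (all? λ x → all? λ δ → ¬? (δ ≟ 𝟎) →-dec ¬? (x ≟ x +₃ δ))

-- Triangle-freeness

square-zero : ∀ x → x *₃ x ≡ 𝟎 → x ≡ 𝟎
square-zero = from-yes (all? λ x → (x *₃ x ≟ 𝟎) →-dec (x ≟ 𝟎))

3∣-of-square : ∀ A X → A ℤ.* A ≡ + 3 ℤ.* X → mod₃ A ≡ 𝟎
3∣-of-square A X A²≡3X = square-zero (mod₃ A) (trans (sym (mod₃-* A A)) (trans (cong mod₃ A²≡3X) (mod₃-* (+ 3) X)))

no-3-square : ∀ k A m → mod₃ m ≢ 𝟎 → A ℤ.* A ≢ + 3 ℤ.* (3^ k ℤ.* m ℤ.* (3^ k ℤ.* m))
no-3-square zero A m 3∤m eq with A′ , refl ← divisible₃ A (3∣-of-square A _ eq) =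
  3∤m (3∣-of-square m (A′ ℤ.* A′) (ℤP.*-cancelˡ-≡ (+ 3) _ _ (trans
    (solve 1 (λ m → con (+ 3) :* (m :* m) := con (+ 3) :* (con (+ 1) :* m :* (con (+ 1) :* m))) refl m)
    (trans (sym eq) (solve 1 (λ a → a :* con (+ 3) :* (a :* con (+ 3)) := con (+ 3) :* (con (+ 3) :* (a :* a))) refl A′)))))
  where open ℤ-Solver
no-3-square (suc k) A m 3∤m eq with A′ , refl ← divisible₃ A (3∣-of-square A _ eq) =
  no-3-square k A′ m 3∤m (ℤP.*-cancelʳ-≡ _ _ (+ 9) (trans
    (solve 1 (λ a → a :* a :* con (+ 9) := a :* con (+ 3) :* (a :* con (+ 3))) refl A′)
    (trans eq (solve 2 (λ P m → con (+ 3) :* (con (+ 3) :* P :* m :* (con (+ 3) :* P :* m))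
                             := con (+ 3) :* (P :* m :* (P :* m)) :* con (+ 9)) refl (3^ k) m))))
  where open ℤ-Solver

square-nonneg : ∀ z → Σ ℕ λ p → z ℤ.* z ≡ + p
square-nonneg (+ m)     = m ℕ.* m , sym (ℤP.pos-* m m)
square-nonneg -[1+ m ] = suc m ℕ.* suc m , refl

re²[0,b]+5b² : ∀ b → ℤ√.re² (+ 5) (+ 0) b ℤ.+ (+ 5) ℤ.* (b ℤ.* b) ≡ + 0
re²[0,b]+5b² = solve 1 (λ b → con (+ 0) :* con (+ 0) :- con (+ 5) :* (b :* b) :+ con (+ 5) :* (b :* b) := con (+ 0)) refl
  where open ℤ-Solver

im²≡ab*2 : ∀ a b → ℤ√.im² a b ≡ a ℤ.* b ℤ.* + 2
im²≡ab*2 = solve 2 (λ a b → a :* b :+ b :* a := a :* b :* con (+ 2)) refl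
  where open ℤ-Solver

re²-nonpositive : ∀ B n → ℤ√.re² (+ 5) (+ 0) B ≢ + 3 ℤ.* (+ suc n ℤ.* + suc n)
re²-nonpositive B n eq with p , B²≡p ← square-nonneg B
  with () ← trans (sym (re²[0,b]+5b² B)) (cong₂ ℤ._+_ eq (trans (cong (+ 5 ℤ.*_) B²≡p) (sym (ℤP.pos-* 5 p))))

no-integral-√3 : ∀ A B n → ℤ√.re² (+ 5) A B ≡ + 3 ℤ.* (+ suc n ℤ.* + suc n) → ℤ√.im² A B ≢ + 0
no-integral-√3 A B n re²≡3N² im²≡0 with ℤP.i*j≡0⇒i≡0∨j≡0 (A ℤ.* B) {+ 2} (trans (sym (im²≡ab*2 A B)) im²≡0)
... | inj₂ ()
... | inj₁ AB≡0 with ℤP.i*j≡0⇒i≡0∨j≡0 A AB≡0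
...   | inj₁ refl = re²-nonpositive B n re²≡3N²
...   | inj₂ refl with k , m , N≡3^km , 3∤m ← factorise₃ n =
  no-3-square k A m 3∤m (trans (solve 1 (λ a → a :* a := a :* a :- con (+ 5) :* (con (+ 0) :* con (+ 0))) refl A)
    (trans re²≡3N² (cong (λ N → + 3 ℤ.* (N ℤ.* N)) N≡3^km)))
  where open ℤ-Solver

threeK : K
threeK = (+ 3 ℚ./ 1) + ℚ.0ℚ √-5

3-not-square : ∀ z → z *K z ≢ threeK
3-not-square z z²≡3 with n , (A , aA) ∷ (B , bB) ∷ [] ← common-denominator (K.re z ∷ K.im z ∷ []) =
  no-integral-√3 A B n re²-cleared im²-cleared
  where
  open ≡-Reasoning
  a = K.re z
  b = K.im z
  N = + suc n
  re²-cleared : ℤ√.re² (+ 5) A B ≡ + 3 ℤ.* (N ℤ.* N)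
  re²-cleared = ι-injective (begin
    ι (ℤ√.re² (+ 5) A B)                        ≡⟨ ι-re²-cleared (+ 5) a b N aA bB ⟩
    ℚ√.re² (ι (+ 5)) a b ℚ.* (ι N ℚ.* ι N)      ≡⟨ cong (λ f → ℚ√.re² f a b ℚ.* (ι N ℚ.* ι N)) ι-5 ⟩
    ℚ√.re² five a b ℚ.* (ι N ℚ.* ι N)           ≡⟨ cong (ℚ._* (ι N ℚ.* ι N)) (trans (cong K.re z²≡3) (sym ι-3)) ⟩
    ι (+ 3) ℚ.* (ι N ℚ.* ι N)                   ≡⟨ cong (ι (+ 3) ℚ.*_) (ι-* N N) ⟨
    ι (+ 3) ℚ.* ι (N ℤ.* N)                     ≡⟨ ι-* (+ 3) (N ℤ.* N) ⟨
    ι (+ 3 ℤ.* (N ℤ.* N))                       ∎)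
  im²-cleared : ℤ√.im² A B ≡ + 0
  im²-cleared = ι-injective (begin
    ι (ℤ√.im² A B)                              ≡⟨ ι-im²-cleared a b N aA bB ⟩
    ℚ√.im² a b ℚ.* (ι N ℚ.* ι N)                ≡⟨ cong (ℚ._* (ι N ℚ.* ι N)) (cong K.im z²≡3) ⟩
    ℚ.0ℚ ℚ.* (ι N ℚ.* ι N)                      ≡⟨ ℚP.*-zeroˡ (ι N ℚ.* ι N) ⟩
    ℚ.0ℚ                                        ≡⟨ ι-0 ⟨
    ι (+ 0)                                     ∎)

twoK fourK : K
twoK  = (+ 2 ℚ./ 1) + ℚ.0ℚ √-5
fourK = (+ 4 ℚ./ 1) + ℚ.0ℚ √-5

sqNorm : K → K → K
sqNorm X₁ X₂ = X₁ *K X₁ +K X₂ *K X₂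

twoDet : K → K → K → K → K
twoDet X₁ X₂ Y₁ Y₂ = twoK *K (X₁ *K Y₂ -K X₂ *K Y₁)

-- 16 · area² of a triangle with squared side lengths A, B, C
heron : K → K → K → K
heron A B C = fourK *K A *K B -K (A +K B -K C) *K (A +K B -K C)

-- Both components of an identity in K are polynomial identities over ℚ in the
-- coordinates and in f = 5; _⊗_ mirrors _*K_ on the solver's syntax.
module K-Syntax where
  open ℚ-Solver

  KPoly : ℕ → Set
  KPoly n = Polynomial n × Polynomial n

  infixl 6 _⊞_ _⊟_

  _⊞_ _⊟_ : ∀ {n} → KPoly n → KPoly n → KPoly n
  (a , b) ⊞ (c , d) = a :+ c , b :+ d
  (a , b) ⊟ (c , d) = a :- c , b :- d

  mul : ∀ {n} → Polynomial n → KPoly n → KPoly n → KPoly n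
  mul f (a , b) (c , d) = a :* c :- f :* (b :* d) , a :* d :+ b :* c

  module _ {n} (f : Polynomial n) (X₁ X₂ Y₁ Y₂ : KPoly n) where
    private
      infixl 7 _⊗_
      _⊗_ : KPoly n → KPoly n → KPoly n
      _⊗_ = mul f
      const : ℚ → KPoly n
      const q = con q , con ℚ.0ℚ
      sqNormP : KPoly n → KPoly n → KPoly n
      sqNormP U V = U ⊗ U ⊞ V ⊗ V
      A = sqNormP X₁ X₂
      B = sqNormP Y₁ Y₂
      C = sqNormP (Y₁ ⊟ X₁) (Y₂ ⊟ X₂)
      D = const (+ 2 ℚ./ 1) ⊗ (X₁ ⊗ Y₂ ⊟ X₂ ⊗ Y₁)

    twoDet² heron′ : KPoly n
    twoDet² = D ⊗ D
    heron′  = const (+ 4 ℚ./ 1) ⊗ A ⊗ B ⊟ (A ⊞ B ⊟ C) ⊗ (A ⊞ B ⊟ C)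

heron-formula : ∀ X₁ X₂ Y₁ Y₂ → twoDet X₁ X₂ Y₁ Y₂ *K twoDet X₁ X₂ Y₁ Y₂ ≡
                heron (sqNorm X₁ X₂) (sqNorm Y₁ Y₂) (sqNorm (Y₁ -K X₁) (Y₂ -K X₂))
heron-formula X₁ X₂ Y₁ Y₂ = cong₂ _+_√-5
  (solve 9 (λ f a b c d e g h i → proj₁ (twoDet² f (a , b) (c , d) (e , g) (h , i))
                               := proj₁ (heron′ f (a , b) (c , d) (e , g) (h , i)))
         refl five (K.re X₁) (K.im X₁) (K.re X₂) (K.im X₂) (K.re Y₁) (K.im Y₁) (K.re Y₂) (K.im Y₂))
  (solve 9 (λ f a b c d e g h i → proj₂ (twoDet² f (a , b) (c , d) (e , g) (h , i))
                               := proj₂ (heron′ f (a , b) (c , d) (e , g) (h , i)))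
         refl five (K.re X₁) (K.im X₁) (K.re X₂) (K.im X₂) (K.re Y₁) (K.im Y₁) (K.re Y₂) (K.im Y₂))
  where open ℚ-Solver; open K-Syntax

sub-cancelʳ : ∀ p q r → (p -K r) -K (q -K r) ≡ p -K q
sub-cancelʳ p q r = cong₂ _+_√-5 (cancel (K.re p) (K.re q) (K.re r)) (cancel (K.im p) (K.im q) (K.im r))
  where
  open ℚ-Solver
  cancel : ∀ p q r → (p ℚ.- r) ℚ.- (q ℚ.- r) ≡ p ℚ.- q
  cancel = solve 3 (λ p q r → (p :- r) :- (q :- r) := p :- q) refl

triangle-free : TriangleFree Adj
triangle-free (x₁ , y₁) (x₂ , y₂) (x₃ , y₃) e₁₂ e₂₃ e₁₃ = 3-not-square (twoDet X₁ X₂ Y₁ Y₂) (begin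
  twoDet X₁ X₂ Y₁ Y₂ *K twoDet X₁ X₂ Y₁ Y₂                          ≡⟨ heron-formula X₁ X₂ Y₁ Y₂ ⟩
  heron (sqNorm X₁ X₂) (sqNorm Y₁ Y₂) (sqNorm (Y₁ -K X₁) (Y₂ -K X₂)) ≡⟨ cong₂ (λ A C → heron A (sqNorm Y₁ Y₂) C) e₁₂ e₂₃′ ⟩
  heron 1K (sqNorm Y₁ Y₂) 1K                                        ≡⟨ cong (λ B → heron 1K B 1K) e₁₃ ⟩
  heron 1K 1K 1K                                                    ≡⟨⟩
  threeK                                                            ∎)
  where
  open ≡-Reasoning
  X₁ = x₂ -K x₁
  X₂ = y₂ -K y₁
  Y₁ = x₃ -K x₁
  Y₂ = y₃ -K y₁
  e₂₃′ : sqNorm (Y₁ -K X₁) (Y₂ -K X₂) ≡ 1K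
  e₂₃′ = trans (cong₂ sqNorm (sub-cancelʳ x₃ x₂ x₁) (sub-cancelʳ y₃ y₂ y₁)) e₂₃

-- Lower bound

no-0-colouring : ∀ {V : Set} (E : V → V → Set) → V → ¬ Colourable E 0
no-0-colouring E v (c , _) with () ← c v

no-1-colouring : ∀ {V : Set} (E : V → V → Set) {u v} → E u v → ¬ Colourable E 1
no-1-colouring E {u} {v} e (c , proper) = proper u v e (from-yes (all? λ (i : Fin 1) → all? λ j → i ≟ j) (c u) (c v))

no-2-colouring : ∀ {V : Set} (E : V → V → Set) {v₀ v₁ v₂ v₃ v₄} →
                 E v₀ v₁ → E v₁ v₂ → E v₂ v₃ → E v₃ v₄ → E v₄ v₀ → ¬ Colourable E 2
no-2-colouring E e₀₁ e₁₂ e₂₃ e₃₄ e₄₀ (c , proper) =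
  proper _ _ e₄₀ (sym (trans (alternate _ _ _ (proper _ _ e₀₁) (proper _ _ e₁₂))
                             (alternate _ _ _ (proper _ _ e₂₃) (proper _ _ e₃₄))))
  where
  alternate : ∀ (i j k : Fin 2) → i ≢ j → j ≢ k → i ≡ k
  alternate = from-yes (all? λ (i : Fin 2) → all? λ j → all? λ k → ¬? (i ≟ j) →-dec (¬? (j ≟ k) →-dec (i ≟ k)))

-- (√-5/2)² + (3/2)² = 1 closes the path p₀ p₁ p₂ p₃ on the second axis into a unit 5-cycle.
p₀ p₁ p₂ p₃ p₄ : K²
p₀ = 0K , 0K
p₁ = 0K , (-[1+ 0 ] ℚ./ 1) + ℚ.0ℚ √-5
p₂ = 0K , (-[1+ 1 ] ℚ./ 1) + ℚ.0ℚ √-5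
p₃ = 0K , (-[1+ 2 ] ℚ./ 1) + ℚ.0ℚ √-5
p₄ = ℚ.0ℚ + (-[1+ 0 ] ℚ./ 2) √-5 , (-[1+ 2 ] ℚ./ 2) + ℚ.0ℚ √-5

lower-bound : ∀ m → m ℕ.< 3 → ¬ Colourable Adj m
lower-bound 0 _ = no-0-colouring Adj p₀
lower-bound 1 _ = no-1-colouring Adj {p₀} {p₁} refl
lower-bound 2 _ = no-2-colouring Adj {p₀} {p₁} {p₂} {p₃} {p₄} refl refl refl refl refl
lower-bound (suc (suc (suc _))) (ℕ.s≤s (ℕ.s≤s (ℕ.s≤s ())))

proposition4p4 : TriangleFree Adj × ChromaticNumber Adj 3
proposition4p4 = triangle-free , (colour , colour-proper) , lower-bound
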